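{- For every $n\ge 1$, $A_n = A_n^r$, where $A_n^r=\{x^r: x\in A_n\}$ and $x^r$ denotes the reversal of the word $x$.
   Context: Words are finite sequences over $\{0,1\}$; for $x=x_1x_2\cdots x_n$, $x^r=x_nx_{n-1}\cdots x_1$. For sets of words $UV=\{uv:u\in U,v\in V\}$ (concatenation). Define $A_1=\{0\}$, $A_2=\{1\}$ and for $n\ge 3$, $A_n=A_{n-1}A_{n-2}\cup A_{n-2}A_{n-1}$. -}

module Defs where

open import Data.Bool using (Bool; false; true)
open import Data.List using (List; []; _∷_; _++_; reverse)
open import Data.Nat using (ℕ; zero; suc)
open import Data.Product using (Σ; _×_; ∃-syntax)
open import Data.Sum using (_⊎_)
open import Data.Empty using (⊥)
open import Relation.Binary.PropositionalEquality using (_≡_)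

-- Words over {0,1}: 0 ↦ false, 1 ↦ true.
Word : Set
Word = List Bool

Lang : Set₁
Lang = Word → Set

_·_ : Lang → Lang → Lang
(U · V) w = ∃[ u ] ∃[ v ] (U u × V v × w ≡ u ++ v)

_∪_ : Lang → Lang → Lang
(U ∪ V) w = U w ⊎ V w

-- A n for n ≥ 1 (A 0 is unused; set to empty).
A : ℕ → Lang
A zero w = ⊥
A (suc zero) w = w ≡ false ∷ []
A (suc (suc zero)) w = w ≡ true ∷ []
A (suc (suc (suc n))) = (A (suc (suc n)) · A (suc n)) ∪ (A (suc n) · A (suc (suc n)))

rev : Lang → Lang
rev L w = ∃[ x ] (L x × w ≡ reverse x)

_≐_ : Lang → Lang → Set
U ≐ V = (∀ w → U w → V w) × (∀ w → V w → U w)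

-- Reversal turns UV into V^r U^r, so it swaps the two halves of
-- A_{n-1}A_{n-2} ∪ A_{n-2}A_{n-1}; by induction every A_n is closed under reversal,
-- and a reversal-closed language equals its reversal since reversal is an involution.
module Submission where

open import Defs
open import Data.Nat using (ℕ; _≥_; zero; suc)
open import Data.List using (reverse)
open import Data.List.Properties using (reverse-++; reverse-involutive)
open import Data.Product using (_,_)
open import Data.Sum using (inj₁; inj₂)
open import Relation.Binary.PropositionalEquality using (refl; sym)

ReversalClosed : Lang → Set
ReversalClosed L = ∀ w → L w → L (reverse w)

reverse-· : ∀ {U V} → ReversalClosed U → ReversalClosed V →
            ∀ w → (U · V) w → (V · U) (reverse w)
reverse-· closedU closedV w (u , v , Uu , Vv , refl) =
  reverse v , reverse u , closedV v Vv , closedU u Uu , reverse-++ u v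

A-reversalClosed : ∀ n → ReversalClosed (A n)
A-reversalClosed zero w ()
A-reversalClosed (suc zero) w refl = refl
A-reversalClosed (suc (suc zero)) w refl = refl
A-reversalClosed (suc (suc (suc n))) w (inj₁ UVw) =
  inj₂ (reverse-· (A-reversalClosed (suc (suc n))) (A-reversalClosed (suc n)) w UVw)
A-reversalClosed (suc (suc (suc n))) w (inj₂ UVw) =
  inj₁ (reverse-· (A-reversalClosed (suc n)) (A-reversalClosed (suc (suc n))) w UVw)

reversalClosed⇒≐rev : ∀ {L} → ReversalClosed L → L ≐ rev L
reversalClosed⇒≐rev closed =
  (λ w Lw → reverse w , closed w Lw , sym (reverse-involutive w)) ,
  (λ { w (x , Lx , refl) → closed x Lx })

proposition2 : ∀ (n : ℕ) → n ≥ 1 → A n ≐ rev (A n)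
proposition2 n _ = reversalClosed⇒≐rev (A-reversalClosed n)
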